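{- Let $m\ge 2$, take the vertex set of $K_{2m+1}$ to be $\{\infty\}\cup\mathbb{Z}_{2m}$, and for $i\in[m]$ let $H_i$ be the Hamiltonian cycle $\infty,\ i,\ i+1,\ i-1,\ i+2,\ i-2,\ \dots,\ i+(m-1),\ i-(m-1),\ i+m,\ \infty$ (arithmetic in $\mathbb{Z}_{2m}$). Let $\ell_i$ be the ordering of $H_i$ given by $\ell_i(\{\infty,i\})=0$, $\ell_i(\{\infty,i+m\})=m$, $\ell_i(\{i+x,i-x\})=x$ for $x\in[m]\setminus\{0\}$, and $\ell_i(\{i+x,i-x+1\})=m+x$ for $x\in[m+1]\setminus\{0\}$. Then for all distinct $i,j\in[m]$, \[ ms_2(\ell_i,\ell_j)\ge 2m+1-|j-i|. \]
   Context: For an integer $N$, $[N]=\{0,\dots,N-1\}$. An ordering of a graph $H=(V,E)$ is a bijection $E\to[|E|]$. A graph is $(\le r)$-regular if each vertex has degree at most $r$. For edge-disjoint graphs $H,H'$ on the same vertex set with orderings $\ell,\ell'$, consider the list of edges of $H$ in the order given by $\ell$ followed by the edges of $H'$ in the order given by $\ell'$; $ms_r(\ell,\ell')$ is the largest integer $s$ such that every $s$ consecutive entries of this list that include at least one edge of $H$ and at least one edge of $H'$ form a $(\le r)$-regular graph. -}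

module Defs where

open import Data.Nat using (ℕ; zero; suc; _+_; _*_; _∸_; _≤_; _<_; _%_; _≡ᵇ_)
open import Data.Bool using (Bool; true; false; if_then_else_; _∨_)
open import Data.Product using (_×_; _,_)
open import Data.List using (List; []; _∷_; map; upTo; take; drop; length; _++_)

-- Vertices are natural numbers.  For K_{2m+1} with vertex set {∞} ∪ ℤ_{2m}
-- we use the residues 0,…,2m-1 for ℤ_{2m} and the number 2m for ∞.
Vertex : Set
Vertex = ℕ

Edge : Set
Edge = Vertex × Vertex

incident : Vertex → Edge → Bool
incident v (a , b) = (v ≡ᵇ a) ∨ (v ≡ᵇ b)

deg : Vertex → List Edge → ℕ
deg v [] = 0
deg v (e ∷ es) = (if incident v e then 1 else 0) + deg v es

LeRegular : ℕ → List Edge → Set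
LeRegular r es = ∀ v → deg v es ≤ r

-- The window starting at position p
-- is  take s (drop p (L₁ ++ L₂))  with p + s ≤ |L₁| + |L₂|; it meets H iff
-- p < |L₁| and meets H' iff |L₁| < p + s.
-- ms_r(ℓ,ℓ') is the largest s with WindowsOK r L₁ L₂ s; since the property is
-- downward closed (for s ≤ |L₁|+|L₂|), ms_r(ℓ,ℓ') ≥ k  iff  WindowsOK r L₁ L₂ k.
WindowsOK : ℕ → List Edge → List Edge → ℕ → Set
WindowsOK r L₁ L₂ s =
  ∀ p → p + s ≤ length L₁ + length L₂ → p < length L₁ → length L₁ < p + s →
  LeRegular r (take s (drop p (L₁ ++ L₂)))

modN : ℕ → ℕ → ℕ
modN zero x = x
modN (suc n) x = x % suc n

-- The edge e of H_i with ℓ_i(e) = p, for p ∈ [2m+1] (n = 2m, ∞ = n):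
--   p = 0            : {∞, i}
--   0 < p < m        : {i+p, i-p}
--   p = m            : {∞, i+m}
--   m < p ≤ 2m, x = p - m : {i+x, i-x+1}
edgeAt : ℕ → ℕ → ℕ → Edge
edgeAt m i p with p ≡ᵇ 0 | p ≡ᵇ m | Data.Nat._<ᵇ_ p m
... | true  | _     | _     = (2 * m , modN (2 * m) i)
... | false | true  | _     = (2 * m , modN (2 * m) (i + m))
... | false | false | true  = (modN (2 * m) (i + p) , modN (2 * m) (i + 2 * m ∸ p))
... | false | false | false =
  (modN (2 * m) (i + (p ∸ m)) , modN (2 * m) (i + 2 * m ∸ (p ∸ m) + 1))

ordList : ℕ → ℕ → List Edge
ordList m i = map (edgeAt m i) (upTo (suc (2 * m)))

-- Every vertex v lies on exactly two edges of each H_i.  A window of length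
-- 2m+1-d of L_i ++ L_j starting at p consists of the edges of H_i at positions
-- ≥ p and the edges of H_j at positions < p - d.  So if the positions F_i, G_i
-- of the two edges at v in H_i exceed the corresponding positions F_j, G_j in
-- H_j by at most d, each of the two pairs contributes at most one edge at v to
-- the window, and v has degree at most 2 there.  For v = ∞ the positions are 0
-- and m in every H_i.  For v = i + y they depend only on y, change by at most 1
-- when y takes one step around ℤ_{2m}, and replacing i by j moves y by |j - i|
-- steps; hence d = |j - i| works.

module Submission where

open import Defs
open import Data.Nat using (ℕ; zero; suc; _+_; _*_; _∸_; _≤_; _<_; z≤n; s≤s; z<s; _≤?_; _<?_; _≡ᵇ_; _%_; NonZero; >-nonZero; ≢-nonZero⁻¹; ∣_-_∣)
open import Data.Nat.Properties
open import Data.Nat.DivMod using (%-distribˡ-+; m%n%n≡m%n; [m+n]%n≡m%n; m%n<n; m<n⇒m%n≡m; n%n≡0)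
open import Data.Bool using (true; false; if_then_else_; T)
open import Data.Unit using (tt)
open import Data.Product using (_×_; _,_; proj₁; proj₂)
open import Data.Sum using (_⊎_; inj₁; inj₂; [_,_]′)
open import Data.List using (List; []; _∷_; applyUpTo; take; drop; length; _++_)
open import Data.List.Properties using (map-upTo; length-applyUpTo)
open import Data.Empty using (⊥; ⊥-elim)
open import Function using (_∘_)
open import Algebra.Properties.CommutativeSemigroup +-commutativeSemigroup using (interchange)
open import Relation.Binary.Definitions using (tri<; tri≈; tri>)
open import Relation.Binary.PropositionalEquality
open import Relation.Nullary using (¬_; yes; no)

inRange : ℕ → ℕ → ℕ → ℕ
inRange k n x with k ≤? x | x <? k + n
... | yes _ | yes _ = 1
... | _     | _     = 0

inRange≤1 : ∀ k n x → inRange k n x ≤ 1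
inRange≤1 k n x with k ≤? x | x <? k + n
... | yes _ | yes _ = s≤s z≤n
... | yes _ | no _  = z≤n
... | no _  | _     = z≤n

inRange⇒bounds : ∀ k n x → 1 ≤ inRange k n x → k ≤ x × x < k + n
inRange⇒bounds k n x h with k ≤? x | x <? k + n
... | yes k≤x | yes x<k+n = k≤x , x<k+n
... | yes _   | no _      = ⊥-elim (1+n≰n h)
... | no _    | _         = ⊥-elim (1+n≰n h)

inRange-suc : ∀ k n x → inRange (suc k) n x ≤ inRange k (suc n) x
inRange-suc k n x with suc k ≤? x | x <? suc k + n | k ≤? x | x <? k + suc n
... | yes _   | yes _ | yes _ | yes _ = ≤-refl
... | yes k<x | yes _ | no k≰x | _    = ⊥-elim (k≰x (<⇒≤ k<x))
... | yes _   | yes x<1+k+n | yes _ | no x≮k+1+n = ⊥-elim (x≮k+1+n (subst (x <_) (sym (+-suc k n)) x<1+k+n))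
... | yes _   | no _  | _     | _     = z≤n
... | no _    | _     | _     | _     = z≤n

inRange-before : ∀ k n → inRange (suc k) n k ≡ 0
inRange-before k n with suc k ≤? k
... | yes k<k = ⊥-elim (1+n≰n k<k)
... | no _    = refl

inRange-first : ∀ k n → inRange k (suc n) k ≡ 1
inRange-first k n with k ≤? k | k <? k + suc n
... | yes _ | yes _       = refl
... | yes _ | no k≮k+1+n  = ⊥-elim (k≮k+1+n (subst (k <_) (sym (+-suc k n)) (s≤s (m≤m+n k n))))
... | no k≰k | _          = ⊥-elim (k≰k ≤-refl)

deg-++ : ∀ v (xs ys : List Edge) → deg v (xs ++ ys) ≡ deg v xs + deg v ys
deg-++ v [] ys = refl
deg-++ v (e ∷ xs) ys rewrite deg-++ v xs ys =
  sym (+-assoc (if incident v e then 1 else 0) (deg v xs) (deg v ys))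

inRange-hit : ∀ {k n X} Y {r} → k ≡ X →
  r ≤ inRange (suc k) n X + inRange (suc k) n Y → suc r ≤ inRange k (suc n) X + inRange k (suc n) Y
inRange-hit {k} {n} Y refl r≤ rewrite inRange-before k n | inRange-first k n =
  s≤s (≤-trans r≤ (inRange-suc k n Y))

inRange-hit′ : ∀ {k n Y} X {r} → k ≡ Y →
  r ≤ inRange (suc k) n X + inRange (suc k) n Y → suc r ≤ inRange k (suc n) X + inRange k (suc n) Y
inRange-hit′ {k} {n} {Y} X {r} k≡Y r≤ =
  subst (suc r ≤_) (+-comm (inRange k (suc n) Y) (inRange k (suc n) X))
    (inRange-hit X k≡Y (subst (r ≤_) (+-comm (inRange (suc k) n X) (inRange (suc k) n Y)) r≤))

deg-applyUpTo≤inRange : ∀ v F G n k (g : ℕ → Edge) →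
  (∀ q → q < n → incident v (g q) ≡ true → k + q ≡ F ⊎ k + q ≡ G) →
  deg v (applyUpTo g n) ≤ inRange k n F + inRange k n G
deg-applyUpTo≤inRange v F G zero k g onlyAt = z≤n
deg-applyUpTo≤inRange v F G (suc n) k g onlyAt
  with deg-applyUpTo≤inRange v F G n (suc k) (g ∘ suc) onlyAt-suc | incident v (g 0) in v∈g0
  where
  onlyAt-suc : ∀ q → q < n → incident v (g (suc q)) ≡ true → suc k + q ≡ F ⊎ suc k + q ≡ G
  onlyAt-suc q q<n v∈gq = subst (λ x → x ≡ F ⊎ x ≡ G) (+-suc k q) (onlyAt (suc q) (s≤s q<n) v∈gq)
... | rest | false = ≤-trans rest (+-mono-≤ (inRange-suc k n F) (inRange-suc k n G))
... | rest | true with onlyAt 0 z<s v∈g0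
...   | inj₁ k+0≡F = inRange-hit G (trans (sym (+-identityʳ k)) k+0≡F) rest
...   | inj₂ k+0≡G = inRange-hit′ F (trans (sym (+-identityʳ k)) k+0≡G) rest

drop-++ : ∀ {A : Set} p (xs ys : List A) → p ≤ length xs → drop p (xs ++ ys) ≡ drop p xs ++ ys
drop-++ zero    xs       ys _         = refl
drop-++ (suc p) (x ∷ xs) ys (s≤s p≤) = drop-++ p xs ys p≤

take-++ : ∀ {A : Set} s (xs ys : List A) → length xs ≤ s →
  take s (xs ++ ys) ≡ xs ++ take (s ∸ length xs) ys
take-++ s       []       ys _         = refl
take-++ (suc s) (x ∷ xs) ys (s≤s ≤s) = cong (x ∷_) (take-++ s xs ys ≤s)

drop-applyUpTo : ∀ {A : Set} p n (g : ℕ → A) → drop p (applyUpTo g n) ≡ applyUpTo (g ∘ (p +_)) (n ∸ p)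
drop-applyUpTo zero    n       g = refl
drop-applyUpTo (suc p) zero    g = refl
drop-applyUpTo (suc p) (suc n) g = drop-applyUpTo p n (g ∘ suc)

take-applyUpTo : ∀ {A : Set} b n (g : ℕ → A) → b ≤ n → take b (applyUpTo g n) ≡ applyUpTo g b
take-applyUpTo zero    n       g _         = refl
take-applyUpTo (suc b) (suc n) g (s≤s b≤n) = cong (g 0 ∷_) (take-applyUpTo b n (g ∘ suc) b≤n)

+≤1 : ∀ {x y} → x ≤ 1 → y ≤ 1 → (1 ≤ x → 1 ≤ y → ⊥) → x + y ≤ 1
+≤1 {zero}        _        y≤1 _    = y≤1
+≤1 {suc zero}    {zero}   _   _    _    = ≤-refl
+≤1 {suc zero}    {suc y}  _   _    both = ⊥-elim (both (s≤s z≤n) (s≤s z≤n))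
+≤1 {suc (suc x)} (s≤s ()) _   _

inRange-disjoint : ∀ {p a d X Y} → X ≤ Y + d → d ≤ p → inRange p a X + inRange 0 (p ∸ d) Y ≤ 1
inRange-disjoint {p} {a} {d} {X} {Y} X≤Y+d d≤p =
  +≤1 (inRange≤1 p a X) (inRange≤1 0 (p ∸ d) Y) λ X∈ Y∈ →
    let p≤X = proj₁ (inRange⇒bounds p a X X∈)
        Y<p∸d = proj₂ (inRange⇒bounds 0 (p ∸ d) Y Y∈)
    in <-irrefl refl (begin-strict
         p            ≤⟨ p≤X ⟩
         X            ≤⟨ X≤Y+d ⟩
         Y + d        <⟨ +-monoˡ-< d Y<p∸d ⟩
         (p ∸ d) + d  ≡⟨ m∸n+n≡m d≤p ⟩
         p            ∎)
  where open ≤-Reasoning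

m<n+[m∸o]⇒o<n : ∀ {N p d} → p ≤ N → N < p + (N ∸ d) → d < p
m<n+[m∸o]⇒o<n {N} {p} {d} p≤N N<p+s with d ≤? N
... | yes d≤N = +-cancelʳ-< (N ∸ d) d p (subst (_< p + (N ∸ d)) (sym (m+[n∸m]≡n d≤N)) N<p+s)
... | no  d≰N = ⊥-elim (<⇒≱ (subst (N <_) (cong (p +_) (m≤n⇒m∸n≡0 (<⇒≤ (≰⇒> d≰N)))) N<p+s)
                              (subst (_≤ N) (sym (+-identityʳ p)) p≤N))

record BoundedLag (g₁ g₂ : ℕ → Edge) (N d : ℕ) (v : Vertex) : Set where
  field
    F₁ G₁ F₂ G₂ : ℕ
    onlyAt₁ : ∀ q → q < N → incident v (g₁ q) ≡ true → q ≡ F₁ ⊎ q ≡ G₁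
    onlyAt₂ : ∀ q → q < N → incident v (g₂ q) ≡ true → q ≡ F₂ ⊎ q ≡ G₂
    F₁≤F₂+d : F₁ ≤ F₂ + d
    G₁≤G₂+d : G₁ ≤ G₂ + d

windowsOK-applyUpTo : ∀ N d (g₁ g₂ : ℕ → Edge) → (∀ v → BoundedLag g₁ g₂ N d v) →
  WindowsOK 2 (applyUpTo g₁ N) (applyUpTo g₂ N) (N ∸ d)
windowsOK-applyUpTo N d g₁ g₂ lag p _ p<|L₁| |L₁|<p+s v =
  subst (λ W → deg v W ≤ 2) (sym window≡head++tail) (begin
    deg v (head ++ tail)
      ≡⟨ deg-++ v head tail ⟩
    deg v head + deg v tail
      ≤⟨ +-mono-≤ (deg-applyUpTo≤inRange v F₁ G₁ a p (g₁ ∘ (p +_)) onlyAtHead)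
                  (deg-applyUpTo≤inRange v F₂ G₂ b 0 g₂ onlyAtTail) ⟩
    (inRange p a F₁ + inRange p a G₁) + (inRange 0 b F₂ + inRange 0 b G₂)
      ≡⟨ interchange (inRange p a F₁) (inRange p a G₁) (inRange 0 b F₂) (inRange 0 b G₂) ⟩
    (inRange p a F₁ + inRange 0 b F₂) + (inRange p a G₁ + inRange 0 b G₂)
      ≤⟨ +-mono-≤ (inRange-disjoint F₁≤F₂+d (<⇒≤ d<p)) (inRange-disjoint G₁≤G₂+d (<⇒≤ d<p)) ⟩
    2 ∎)
  where
  open BoundedLag (lag v)
  open ≤-Reasoning
  L₁ = applyUpTo g₁ N
  L₂ = applyUpTo g₂ N
  a = N ∸ p
  b = p ∸ d
  head = applyUpTo (g₁ ∘ (p +_)) a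
  tail = applyUpTo g₂ b

  p<N : p < N
  p<N = subst (p <_) (length-applyUpTo g₁ N) p<|L₁|
  d<p : d < p
  d<p = m<n+[m∸o]⇒o<n (<⇒≤ p<N) (subst (_< p + (N ∸ d)) (length-applyUpTo g₁ N) |L₁|<p+s)
  N∸d≡a+b : N ∸ d ≡ a + b
  N∸d≡a+b = trans (cong (_∸ d) (sym (m∸n+n≡m (<⇒≤ p<N)))) (+-∸-assoc a (<⇒≤ d<p))

  window≡head++tail : take (N ∸ d) (drop p (L₁ ++ L₂)) ≡ head ++ tail
  window≡head++tail = ≡.begin
    take (N ∸ d) (drop p (L₁ ++ L₂))
      ≡.≡⟨ cong (take (N ∸ d)) (drop-++ p L₁ L₂ (subst (p ≤_) (sym (length-applyUpTo g₁ N)) (<⇒≤ p<N))) ⟩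
    take (N ∸ d) (drop p L₁ ++ L₂)
      ≡.≡⟨ cong (λ xs → take (N ∸ d) (xs ++ L₂)) (drop-applyUpTo p N g₁) ⟩
    take (N ∸ d) (head ++ L₂)
      ≡.≡⟨ take-++ (N ∸ d) head L₂ (subst₂ _≤_ (sym (length-applyUpTo _ a)) (sym N∸d≡a+b) (m≤m+n a b)) ⟩
    head ++ take (N ∸ d ∸ length head) L₂
      ≡.≡⟨ cong (λ k → head ++ take k L₂)
                 (trans (cong₂ _∸_ N∸d≡a+b (length-applyUpTo _ a)) (m+n∸m≡n a b)) ⟩
    head ++ take b L₂
      ≡.≡⟨ cong (head ++_) (take-applyUpTo b N g₂ (≤-trans (m∸n≤m p d) (<⇒≤ p<N))) ⟩
    head ++ tail ≡.∎
    where module ≡ = ≡-Reasoning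

  onlyAtHead : ∀ q → q < a → incident v (g₁ (p + q)) ≡ true → p + q ≡ F₁ ⊎ p + q ≡ G₁
  onlyAtHead q q<a = onlyAt₁ (p + q) (subst (p + q <_) (m+[n∸m]≡n (<⇒≤ p<N)) (+-monoʳ-< p q<a))
  onlyAtTail : ∀ q → q < b → incident v (g₂ q) ≡ true → q ≡ F₂ ⊎ q ≡ G₂
  onlyAtTail q q<b = onlyAt₂ q (<-≤-trans q<b (≤-trans (m∸n≤m p d) (<⇒≤ p<N)))

1-Lipschitz : ∀ (f : ℕ → ℕ) b → (∀ k → k < b → ∣ f k - f (suc k) ∣ ≤ 1) →
  ∀ {x y} → x ≤ b → y ≤ b → ∣ f x - f y ∣ ≤ ∣ x - y ∣
1-Lipschitz f b step {x} {y} x≤b y≤b =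
  [ (λ x≤y → ascending x≤y y≤b)
  , (λ y≤x → subst₂ _≤_ (∣-∣-comm (f y) (f x)) (∣-∣-comm y x) (ascending y≤x x≤b)) ]′ (≤-total x y)
  where
  forward : ∀ x e → x + e ≤ b → ∣ f x - f (x + e) ∣ ≤ e
  forward x zero _ = ≤-reflexive (trans (cong (λ z → ∣ f x - f z ∣) (+-identityʳ x)) (∣n-n∣≡0 (f x)))
  forward x (suc e) x+1+e≤b = begin
    ∣ f x - f (x + suc e) ∣                            ≡⟨ cong (λ z → ∣ f x - f z ∣) (+-suc x e) ⟩
    ∣ f x - f (suc (x + e)) ∣                          ≤⟨ ∣-∣-triangle (f x) (f (x + e)) (f (suc (x + e))) ⟩
    ∣ f x - f (x + e) ∣ + ∣ f (x + e) - f (suc (x + e)) ∣ ≤⟨ +-mono-≤ (forward x e (<⇒≤ x+e<b)) (step (x + e) x+e<b) ⟩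
    e + 1                                              ≡⟨ +-comm e 1 ⟩
    suc e                                              ∎
    where
    open ≤-Reasoning
    x+e<b : x + e < b
    x+e<b = subst (_≤ b) (+-suc x e) x+1+e≤b
  ascending : ∀ {x y} → x ≤ y → y ≤ b → ∣ f x - f y ∣ ≤ ∣ x - y ∣
  ascending {x} {y} x≤y y≤b =
    subst₂ (λ z e → ∣ f x - f z ∣ ≤ e) (m+[n∸m]≡n x≤y) (sym (m≤n⇒∣m-n∣≡n∸m x≤y))
      (forward x (y ∸ x) (subst (_≤ b) (sym (m+[n∸m]≡n x≤y)) y≤b))

∣n-1+n∣≡1 : ∀ a → ∣ a - suc a ∣ ≡ 1
∣n-1+n∣≡1 zero    = refl
∣n-1+n∣≡1 (suc a) = ∣n-1+n∣≡1 a

∣-∣≤1-suc : ∀ {a b} → suc a ≡ b → ∣ a - b ∣ ≤ 1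
∣-∣≤1-suc {a} refl = ≤-reflexive (∣n-1+n∣≡1 a)

∣-∣≤1-pred : ∀ {a b} → a ≡ suc b → ∣ a - b ∣ ≤ 1
∣-∣≤1-pred {a} {b} a≡1+b = subst (_≤ 1) (∣-∣-comm b a) (∣-∣≤1-suc (sym a≡1+b))

∣-∣≤1-refl : ∀ {a b} → a ≡ b → ∣ a - b ∣ ≤ 1
∣-∣≤1-refl a≡b = ≤-trans (≤-reflexive (m≡n⇒∣m-n∣≡0 a≡b)) z≤n

suc[m∸1+n]≡m∸n : ∀ {a i} → suc i ≤ a → suc (a ∸ suc i) ≡ a ∸ i
suc[m∸1+n]≡m∸n {a} 1+i≤a = sym (+-∸-assoc 1 1+i≤a)

[m%n+o]%n≡[m+o]%n : ∀ a o n .{{_ : NonZero n}} → (a % n + o) % n ≡ (a + o) % n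
[m%n+o]%n≡[m+o]%n a o n = begin
  (a % n + o) % n          ≡⟨ %-distribˡ-+ (a % n) o n ⟩
  (a % n % n + o % n) % n  ≡⟨ cong (λ z → (z + o % n) % n) (m%n%n≡m%n a n) ⟩
  (a % n + o % n) % n      ≡⟨ %-distribˡ-+ a o n ⟨
  (a + o) % n              ∎
  where open ≡-Reasoning

modN≡% : ∀ n x .{{_ : NonZero n}} → modN n x ≡ x % n
modN≡% zero    x = ⊥-elim (≢-nonZero⁻¹ 0 refl)
modN≡% (suc n) x = refl

incident-split : ∀ {v a b} → incident v (a , b) ≡ true → v ≡ a ⊎ v ≡ b
incident-split {v} {a} {b} v∈ab with v ≡ᵇ a in v≡ᵇa | v ≡ᵇ b in v≡ᵇb
... | true  | _    = inj₁ (≡ᵇ⇒≡ v a (subst T (sym v≡ᵇa) tt))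
... | false | true = inj₂ (≡ᵇ⇒≡ v b (subst T (sym v≡ᵇb) tt))

T⇒≡true : ∀ {b} → T b → b ≡ true
T⇒≡true {true} _ = refl

¬T⇒≡false : ∀ {b} → ¬ T b → b ≡ false
¬T⇒≡false {false} _  = refl
¬T⇒≡false {true}  ¬t = ⊥-elim (¬t tt)

module HamiltonCycle (m : ℕ) (2≤m : 2 ≤ m) where

  n : ℕ
  n = 2 * m

  n≡m+m : n ≡ m + m
  n≡m+m = cong (m +_) (+-identityʳ m)

  0<m : 0 < m
  0<m = <-≤-trans z<s 2≤m

  m<n : m < n
  m<n = subst (m <_) (sym n≡m+m) (m<m+n m 0<m)

  n∸m≡m : n ∸ m ≡ m
  n∸m≡m = trans (cong (_∸ m) n≡m+m) (m+n∸m≡n m m)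

  instance
    n-nonZero : NonZero n
    n-nonZero = >-nonZero (<-trans 0<m m<n)

  -- For the vertex i + y, chordPos y is the ℓ_i-position of its edge {i+x, i-x}
  -- (or {∞, i}, {∞, i+m}), and diagonalPos y that of its edge {i+x, i-x+1}.
  chordPos : ℕ → ℕ
  chordPos y with y ≤? m
  ... | yes _ = y
  ... | no  _ = n ∸ y

  diagonalPos : ℕ → ℕ
  diagonalPos zero = suc m
  diagonalPos (suc y) with suc y ≤? m
  ... | yes _ = m + suc y
  ... | no  _ = m + suc n ∸ suc y

  chordPos-≤ : ∀ {y} → y ≤ m → chordPos y ≡ y
  chordPos-≤ {y} y≤m with y ≤? m
  ... | yes _   = refl
  ... | no  y≰m = ⊥-elim (y≰m y≤m)

  chordPos-> : ∀ {y} → m < y → chordPos y ≡ n ∸ y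
  chordPos-> {y} m<y with y ≤? m
  ... | yes y≤m = ⊥-elim (<⇒≱ m<y y≤m)
  ... | no  _   = refl

  diagonalPos-≤ : ∀ {y} → 0 < y → y ≤ m → diagonalPos y ≡ m + y
  diagonalPos-≤ {suc y} _ y≤m with suc y ≤? m
  ... | yes _   = refl
  ... | no  y≰m = ⊥-elim (y≰m y≤m)

  diagonalPos-> : ∀ {y} → m < y → diagonalPos y ≡ m + suc n ∸ y
  diagonalPos-> {suc y} m<y with suc y ≤? m
  ... | yes y≤m = ⊥-elim (<⇒≱ m<y y≤m)
  ... | no  _   = refl

  chordPos-periodic : chordPos n ≡ chordPos 0
  chordPos-periodic = trans (chordPos-> m<n) (trans (n∸n≡0 n) (sym (chordPos-≤ z≤n)))

  diagonalPos-periodic : diagonalPos n ≡ diagonalPos 0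
  diagonalPos-periodic =
    trans (diagonalPos-> m<n) (trans (cong (_∸ n) (+-suc m n)) (m+n∸n≡m (suc m) n))

  chordPos-step : ∀ w → w < n → ∣ chordPos w - chordPos (suc w) ∣ ≤ 1
  chordPos-step w w<n with <-cmp w m
  ... | tri< w<m _ _ = ∣-∣≤1-suc (trans (cong suc (chordPos-≤ (<⇒≤ w<m))) (sym (chordPos-≤ w<m)))
  ... | tri≈ _ refl _ = ∣-∣≤1-pred (begin
    chordPos m               ≡⟨ chordPos-≤ ≤-refl ⟩
    m                        ≡⟨ n∸m≡m ⟨
    n ∸ m                    ≡⟨ suc[m∸1+n]≡m∸n m<n ⟨
    suc (n ∸ suc m)          ≡⟨ cong suc (chordPos-> (n<1+n m)) ⟨
    suc (chordPos (suc m))   ∎)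
    where open ≡-Reasoning
  ... | tri> _ _ m<w = ∣-∣≤1-pred (trans (chordPos-> m<w)
                         (trans (sym (suc[m∸1+n]≡m∸n w<n)) (cong suc (sym (chordPos-> (m<n⇒m<1+n m<w))))))

  diagonalPos-step : ∀ w → w < n → ∣ diagonalPos w - diagonalPos (suc w) ∣ ≤ 1
  diagonalPos-step zero _ = ∣-∣≤1-refl (trans (+-comm 1 m) (sym (diagonalPos-≤ z<s 0<m)))
  diagonalPos-step w@(suc _) w<n with <-cmp w m
  ... | tri< w<m _ _ = ∣-∣≤1-suc (trans (cong suc (diagonalPos-≤ z<s (<⇒≤ w<m)))
                         (trans (sym (+-suc m w)) (sym (diagonalPos-≤ z<s w<m))))
  ... | tri≈ _ refl _ = ∣-∣≤1-refl (begin
    diagonalPos m            ≡⟨ diagonalPos-≤ 0<m ≤-refl ⟩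
    m + m                    ≡⟨ n≡m+m ⟨
    n                        ≡⟨ m+n∸m≡n m n ⟨
    m + n ∸ m                ≡⟨ cong (_∸ suc m) (+-suc m n) ⟨
    m + suc n ∸ suc m        ≡⟨ diagonalPos-> (n<1+n m) ⟨
    diagonalPos (suc m)      ∎)
    where open ≡-Reasoning
  ... | tri> _ _ m<w = ∣-∣≤1-pred (trans (diagonalPos-> m<w)
                         (trans (sym (suc[m∸1+n]≡m∸n (≤-trans w<n (≤-trans (n≤1+n n) (m≤n+m (suc n) m)))))
                           (cong suc (sym (diagonalPos-> (m<n⇒m<1+n m<w))))))

  -- The y with v = i + y in ℤ_{2m}; meaningful for v < n, since n encodes ∞.
  offset : ℕ → Vertex → ℕ
  offset i v = (v + n ∸ i) % n

  offset-endpoint : ∀ {i v} e → i ≤ n → v ≡ modN n (i + e) → offset i v ≡ e % n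
  offset-endpoint {i} {v} e i≤n v≡i+e = begin
    (v + n ∸ i) % n              ≡⟨ cong (_% n) (+-∸-assoc v i≤n) ⟩
    (v + (n ∸ i)) % n            ≡⟨ cong (λ z → (z + (n ∸ i)) % n) (trans v≡i+e (modN≡% n (i + e))) ⟩
    ((i + e) % n + (n ∸ i)) % n  ≡⟨ [m%n+o]%n≡[m+o]%n (i + e) (n ∸ i) n ⟩
    (i + e + (n ∸ i)) % n        ≡⟨ cong (_% n) i+e+[n∸i]≡e+n ⟩
    (e + n) % n                  ≡⟨ [m+n]%n≡m%n e n ⟩
    e % n                        ∎
    where
    open ≡-Reasoning
    i+e+[n∸i]≡e+n : i + e + (n ∸ i) ≡ e + n
    i+e+[n∸i]≡e+n = trans (cong (_+ (n ∸ i)) (+-comm i e))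
                      (trans (+-assoc e i (n ∸ i)) (cong (e +_) (m+[n∸m]≡n i≤n)))

  offset-suc : ∀ {i} v → suc i ≤ n → offset i v ≡ suc (offset (suc i) v) % n
  offset-suc {i} v 1+i≤n = sym (begin
    suc (x % n) % n  ≡⟨ cong (_% n) (+-comm 1 (x % n)) ⟩
    (x % n + 1) % n  ≡⟨ [m%n+o]%n≡[m+o]%n x 1 n ⟩
    (x + 1) % n      ≡⟨ cong (_% n) (+-comm x 1) ⟩
    suc x % n        ≡⟨ cong (_% n) (suc[m∸1+n]≡m∸n (≤-trans 1+i≤n (m≤n+m n v))) ⟩
    offset i v       ∎)
    where
    open ≡-Reasoning
    x = v + n ∸ suc i

  cyclic-step : ∀ (φ : ℕ → ℕ) → φ n ≡ φ 0 → (∀ w → w < n → ∣ φ w - φ (suc w) ∣ ≤ 1) →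
    ∀ w → w < n → ∣ φ w - φ (suc w % n) ∣ ≤ 1
  cyclic-step φ periodic step w w<n = subst (λ z → ∣ φ w - z ∣ ≤ 1) φ[1+w]≡φ[1+w%n] (step w w<n)
    where
    φ[1+w]≡φ[1+w%n] : φ (suc w) ≡ φ (suc w % n)
    φ[1+w]≡φ[1+w%n] with m≤n⇒m<n∨m≡n w<n
    ... | inj₁ 1+w<n = cong φ (sym (m<n⇒m%n≡m 1+w<n))
    ... | inj₂ 1+w≡n = trans (cong φ 1+w≡n) (trans periodic (cong φ (sym (trans (cong (_% n) 1+w≡n) (n%n≡0 n)))))

  offset-Lipschitz : ∀ (φ : ℕ → ℕ) → φ n ≡ φ 0 → (∀ w → w < n → ∣ φ w - φ (suc w) ∣ ≤ 1) →
    ∀ v {i j} → i ≤ n → j ≤ n → ∣ φ (offset i v) - φ (offset j v) ∣ ≤ ∣ i - j ∣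
  offset-Lipschitz φ periodic step v = 1-Lipschitz (λ k → φ (offset k v)) n offset-step
    where
    offset-step : ∀ k → k < n → ∣ φ (offset k v) - φ (offset (suc k) v) ∣ ≤ 1
    offset-step k k<n =
      subst (λ y → ∣ φ y - φ w ∣ ≤ 1) (sym (offset-suc v k<n))
        (subst (_≤ 1) (∣-∣-comm (φ w) (φ (suc w % n))) (cyclic-step φ periodic step w (m%n<n _ n)))
      where w = offset (suc k) v

  data Slot : ℕ → Set where
    ∞-start  : Slot 0
    ∞-middle : Slot m
    chord    : ∀ {x} → 0 < x → x < m → Slot x
    diagonal : ∀ {x} → 0 < x → x ≤ m → Slot (m + x)

  slot : ∀ {q} → q < suc n → Slot q
  slot {zero}  _ = ∞-start
  slot {suc q} q<1+n with <-cmp (suc q) m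
  ... | tri< q<m _ _ = chord z<s q<m
  ... | tri≈ _ q≡m _ = subst Slot (sym q≡m) ∞-middle
  ... | tri> _ _ m<q = subst Slot (m+[n∸m]≡n (<⇒≤ m<q))
                         (diagonal (m<n⇒0<n∸m m<q) (subst (suc q ∸ m ≤_) n∸m≡m (∸-monoˡ-≤ m (≤-pred q<1+n))))

  edgeAt-∞-middle : ∀ i → edgeAt m i m ≡ (n , modN n (i + m))
  edgeAt-∞-middle i
    rewrite ¬T⇒≡false (>⇒≢ 0<m ∘ ≡ᵇ⇒≡ m 0) | T⇒≡true (≡⇒≡ᵇ m m refl) = refl

  edgeAt-chord : ∀ i {x} → 0 < x → x < m → edgeAt m i x ≡ (modN n (i + x) , modN n (i + n ∸ x))
  edgeAt-chord i {x} 0<x x<m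
    rewrite ¬T⇒≡false (>⇒≢ 0<x ∘ ≡ᵇ⇒≡ x 0) | ¬T⇒≡false (<⇒≢ x<m ∘ ≡ᵇ⇒≡ x m) | T⇒≡true (<⇒<ᵇ x<m) = refl

  edgeAt-diagonal : ∀ i {x} → 0 < x → x ≤ m →
    edgeAt m i (m + x) ≡ (modN n (i + x) , modN n (i + n ∸ x + 1))
  edgeAt-diagonal i {x} 0<x x≤m
    rewrite ¬T⇒≡false (>⇒≢ (<-≤-trans 0<m (m≤m+n m x)) ∘ ≡ᵇ⇒≡ (m + x) 0)
          | ¬T⇒≡false (>⇒≢ (m<m+n m 0<x) ∘ ≡ᵇ⇒≡ (m + x) m)
          | ¬T⇒≡false (≤⇒≯ (m≤m+n m x) ∘ <ᵇ⇒< (m + x) m)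
          | m+n∸m≡n m x = refl

  offset-at : ∀ {i v} e → i ≤ n → e < n → v ≡ modN n (i + e) → offset i v ≡ e
  offset-at e i≤n e<n v≡i+e = trans (offset-endpoint e i≤n v≡i+e) (m<n⇒m%n≡m e<n)

  chordPos-mirror : ∀ {x} → x < m → chordPos (n ∸ x) ≡ x
  chordPos-mirror {x} x<m = trans (chordPos-> (subst (_< n ∸ x) n∸m≡m (∸-monoʳ-< x<m (<⇒≤ m<n))))
                                  (m∸[m∸n]≡n (<⇒≤ (<-trans x<m m<n)))

  diagonalPos-mirror : ∀ {x} → 0 < x → x ≤ m → diagonalPos (suc (n ∸ x) % n) ≡ m + x
  diagonalPos-mirror {x} 0<x x≤m with m≤n⇒m<n∨m≡n 0<x
  ... | inj₂ refl = begin
    diagonalPos (suc (n ∸ 1) % n)  ≡⟨ cong (λ z → diagonalPos (z % n)) (suc[m∸1+n]≡m∸n (<-trans 0<m m<n)) ⟩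
    diagonalPos (n % n)            ≡⟨ cong diagonalPos (n%n≡0 n) ⟩
    suc m                          ≡⟨ +-comm 1 m ⟩
    m + 1                          ∎
    where open ≡-Reasoning
  ... | inj₁ 1<x = begin
    diagonalPos (suc (n ∸ x) % n)  ≡⟨ cong diagonalPos (m<n⇒m%n≡m 1+n∸x<n) ⟩
    diagonalPos (suc (n ∸ x))      ≡⟨ diagonalPos-> (s≤s m≤n∸x) ⟩
    m + suc n ∸ suc (n ∸ x)        ≡⟨ cong (_∸ suc (n ∸ x)) (+-suc m n) ⟩
    m + n ∸ (n ∸ x)                ≡⟨ +-∸-assoc m (m∸n≤m n x) ⟩
    m + (n ∸ (n ∸ x))              ≡⟨ cong (m +_) (m∸[m∸n]≡n x≤n) ⟩
    m + x                          ∎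
    where
    open ≡-Reasoning
    x≤n : x ≤ n
    x≤n = ≤-trans x≤m (<⇒≤ m<n)
    m≤n∸x : m ≤ n ∸ x
    m≤n∸x = subst (_≤ n ∸ x) n∸m≡m (∸-monoʳ-≤ n x≤m)
    1+n∸x<n : suc (n ∸ x) < n
    1+n∸x<n = subst (suc (suc (n ∸ x)) ≤_) (suc[m∸1+n]≡m∸n (<-trans 0<m m<n)) (s≤s (∸-monoʳ-< 1<x x≤n))

  modN<n : ∀ x → modN n x < n
  modN<n x = subst (_< n) (sym (modN≡% n x)) (m%n<n x n)

  incident-modN : ∀ {v a b} → incident v (modN n a , modN n b) ≡ true → v < n
  incident-modN {v} {a} {b} v∈ with incident-split v∈
  ... | inj₁ v≡a = subst (_< n) (sym v≡a) (modN<n a)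
  ... | inj₂ v≡b = subst (_< n) (sym v≡b) (modN<n b)

  incident-∞ : ∀ {v} i {q} → n ≤ v → q < suc n → incident v (edgeAt m i q) ≡ true → q ≡ 0 ⊎ q ≡ m
  incident-∞ {v} i n≤v q<1+n = at (slot q<1+n)
    where
    finite : ∀ {a b} → incident v (modN n a , modN n b) ≡ true → ∀ {A : Set} → A
    finite v∈ = ⊥-elim (<⇒≱ (incident-modN v∈) n≤v)
    at : ∀ {q} → Slot q → incident v (edgeAt m i q) ≡ true → q ≡ 0 ⊎ q ≡ m
    at ∞-start              _  = inj₁ refl
    at ∞-middle             _  = inj₂ refl
    at (chord 0<x x<m)      v∈ = finite (subst (λ e → incident v e ≡ true) (edgeAt-chord i 0<x x<m) v∈)
    at (diagonal 0<x x≤m)   v∈ = finite (subst (λ e → incident v e ≡ true) (edgeAt-diagonal i 0<x x≤m) v∈)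

  incident-offset : ∀ {v i q} → v < n → i ≤ n → q < suc n → incident v (edgeAt m i q) ≡ true →
    q ≡ chordPos (offset i v) ⊎ q ≡ diagonalPos (offset i v)
  incident-offset {v} {i} v<n i≤n q<1+n = at (slot q<1+n)
    where
    Onto : ℕ → Set
    Onto q = q ≡ chordPos (offset i v) ⊎ q ≡ diagonalPos (offset i v)

    chordAt : ∀ {y q} → offset i v ≡ y → chordPos y ≡ q → Onto q
    chordAt o≡y φy≡q = inj₁ (sym (trans (cong chordPos o≡y) φy≡q))
    diagonalAt : ∀ {y q} → offset i v ≡ y → diagonalPos y ≡ q → Onto q
    diagonalAt o≡y φy≡q = inj₂ (sym (trans (cong diagonalPos o≡y) φy≡q))

    split : ∀ {e a b} → e ≡ (a , b) → incident v e ≡ true → v ≡ a ⊎ v ≡ b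
    split e≡ab v∈ = incident-split (subst (λ e → incident v e ≡ true) e≡ab v∈)

    at : ∀ {q} → Slot q → incident v (edgeAt m i q) ≡ true → Onto q
    at ∞-start v∈ with split refl v∈
    ... | inj₁ v≡n = ⊥-elim (<-irrefl v≡n v<n)
    ... | inj₂ v≡i = chordAt (offset-at 0 i≤n (<-trans 0<m m<n) (trans v≡i (cong (modN n) (sym (+-identityʳ i)))))
                             (chordPos-≤ z≤n)
    at ∞-middle v∈ with split (edgeAt-∞-middle i) v∈
    ... | inj₁ v≡n   = ⊥-elim (<-irrefl v≡n v<n)
    ... | inj₂ v≡i+m = chordAt (offset-at m i≤n m<n v≡i+m) (chordPos-≤ ≤-refl)
    at (chord {x} 0<x x<m) v∈ with split (edgeAt-chord i 0<x x<m) v∈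
    ... | inj₁ v≡i+x = chordAt (offset-at x i≤n (<-trans x<m m<n) v≡i+x) (chordPos-≤ (<⇒≤ x<m))
    ... | inj₂ v≡i-x = chordAt (offset-at (n ∸ x) i≤n (∸-monoʳ-< 0<x x≤n)
                                 (trans v≡i-x (cong (modN n) (+-∸-assoc i x≤n))))
                               (chordPos-mirror x<m)
      where
      x≤n : x ≤ n
      x≤n = <⇒≤ (<-trans x<m m<n)
    at (diagonal {x} 0<x x≤m) v∈ with split (edgeAt-diagonal i 0<x x≤m) v∈
    ... | inj₁ v≡i+x   = diagonalAt (offset-at x i≤n (≤-<-trans x≤m m<n) v≡i+x) (diagonalPos-≤ 0<x x≤m)
    ... | inj₂ v≡i-x+1 = diagonalAt (offset-endpoint (suc (n ∸ x)) i≤n (trans v≡i-x+1 (cong (modN n) i+n∸x+1≡)))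
                                    (diagonalPos-mirror 0<x x≤m)
      where
      i+n∸x+1≡ : i + n ∸ x + 1 ≡ i + suc (n ∸ x)
      i+n∸x+1≡ = trans (cong (_+ 1) (+-∸-assoc i (≤-trans x≤m (<⇒≤ m<n))))
                   (trans (+-comm (i + (n ∸ x)) 1) (sym (+-suc i (n ∸ x))))

  boundedLag : ∀ {i j} → i ≤ n → j ≤ n → ∀ v → BoundedLag (edgeAt m i) (edgeAt m j) (suc n) ∣ j - i ∣ v
  boundedLag {i} {j} i≤n j≤n v with v <? n
  ... | yes v<n = record
    { F₁ = chordPos (offset i v) ; G₁ = diagonalPos (offset i v)
    ; F₂ = chordPos (offset j v) ; G₂ = diagonalPos (offset j v)
    ; onlyAt₁ = λ _ → incident-offset v<n i≤n
    ; onlyAt₂ = λ _ → incident-offset v<n j≤n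
    ; F₁≤F₂+d = lag chordPos chordPos-periodic chordPos-step
    ; G₁≤G₂+d = lag diagonalPos diagonalPos-periodic diagonalPos-step
    }
    where
    lag : ∀ φ → φ n ≡ φ 0 → (∀ w → w < n → ∣ φ w - φ (suc w) ∣ ≤ 1) →
      φ (offset i v) ≤ φ (offset j v) + ∣ j - i ∣
    lag φ periodic step = ≤-trans (m≤n+∣m-n∣ (φ (offset i v)) (φ (offset j v)))
      (+-monoʳ-≤ (φ (offset j v)) (subst (∣ φ (offset i v) - φ (offset j v) ∣ ≤_) (∣-∣-comm i j) (offset-Lipschitz φ periodic step v i≤n j≤n)))
  ... | no v≮n = record
    { F₁ = 0 ; G₁ = m ; F₂ = 0 ; G₂ = m
    ; onlyAt₁ = λ _ → incident-∞ i (≮⇒≥ v≮n)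
    ; onlyAt₂ = λ _ → incident-∞ j (≮⇒≥ v≮n)
    ; F₁≤F₂+d = z≤n
    ; G₁≤G₂+d = m≤m+n m _
    }

lemma27 : (m : ℕ) → 2 ≤ m → (i j : ℕ) → i < m → j < m → i ≢ j →
    WindowsOK 2 (ordList m i) (ordList m j) (suc (2 * m) ∸ ∣ j - i ∣)
lemma27 m 2≤m i j i<m j<m _ =
  subst₂ (λ L₁ L₂ → WindowsOK 2 L₁ L₂ (suc (2 * m) ∸ ∣ j - i ∣))
    (sym (map-upTo (edgeAt m i) (suc (2 * m)))) (sym (map-upTo (edgeAt m j) (suc (2 * m))))
    (windowsOK-applyUpTo (suc (2 * m)) ∣ j - i ∣ (edgeAt m i) (edgeAt m j)
      (boundedLag (<⇒≤ (<-trans i<m m<n)) (<⇒≤ (<-trans j<m m<n))))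
  where open HamiltonCycle m 2≤m using (boundedLag; m<n)
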